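{- If $\tilde\Sigma=((x_1,\dots,x_s),(\sigma_1,\dots,\sigma_s),Q)$ is a signed seed, then $\mu_k(\tilde\Sigma)$ is a signed seed for any mutable direction $k$.
   Context: A quiver $Q$ is a finite directed graph without loops or 2-cycles, on vertices $v_1,\dots,v_s$, of which $v_1,\dots,v_r$ are mutable and the rest frozen. Quiver mutation $\mu_k$ at a mutable vertex $v_k$: (1) for each path $v_i\to v_k\to v_j$ add an arrow $v_i\to v_j$; (2) reverse all arrows incident to $v_k$; (3) remove a maximal set of pairwise disjoint 2-cycles. A seed is a pair $((x_1,\dots,x_s),Q)$ of a free generating set of a field of rational functions and such a quiver; seed mutation $\mu_k$ replaces $Q$ by $\mu_k(Q)$ and $x_k$ by $x_k'$ with $x_kx_k'=\prod_{v_k\to v_j}x_j+\prod_{v_j\to v_k}x_j$ (products with multiplicity), other $x_i$ unchanged. Given signs $(\sigma_1,\dots,\sigma_s)\in\{1,-1\}^s$ attached to the vertices, for a mutable vertex $v_i$ set $\mathrm{in}^Q_\sigma(v_i)=\prod_{v_j\to v_i}\sigma_j$ and $\mathrm{out}^Q_\sigma(v_i)=\prod_{v_i\to v_j}\sigma_j$ (products over arrows, with multiplicity). The triple $((x_1,\dots,x_s),(\sigma_1,\dots,\sigma_s),Q)$ is a signed seed if $\mathrm{in}^Q_\sigma(v_i)=\mathrm{out}^Q_\sigma(v_i)$ for every mutable vertex $v_i$. Mutation of signed seeds: $\mu_k(\tilde\Sigma)=(\mu_k(x_1,\dots,x_s),(\sigma_1',\dots,\sigma_s'),\mu_k(Q))$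 with $\sigma_k'=\sigma_k\cdot\mathrm{in}^Q_\sigma(v_k)$ and $\sigma_i'=\sigma_i$ for $i\ne k$ (vertex labels are preserved under mutation). -}

module Defs where

open import Data.Nat using (ℕ; zero; suc; _+_; _*_; _∸_; _<_)
open import Data.Fin using (Fin; toℕ; _≟_)
import Data.Fin as Fin
open import Data.Sign using (Sign) renaming (_*_ to _·_)
import Data.Sign as Sign
open import Data.Sum using (_⊎_)
open import Relation.Binary.PropositionalEquality using (_≡_)
open import Relation.Nullary.Decidable using (does)
open import Data.Bool using (if_then_else_)

-- A quiver on the vertex set Fin s is given by its arrow-count function:
-- arrows i j = number of arrows v_i → v_j.
Arrows : ℕ → Set
Arrows s = Fin s → Fin s → ℕ

record IsQuiver {s : ℕ} (a : Arrows s) : Set where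
  field
    noLoops    : ∀ i → a i i ≡ 0
    no2cycles  : ∀ i j → a i j ≡ 0 ⊎ a j i ≡ 0

-- Vertices v_1..v_r are mutable (0-based: toℕ i < r), the rest are frozen.
Mutable : {s : ℕ} → ℕ → Fin s → Set
Mutable r i = toℕ i < r

-- Quiver mutation μ_k at vertex k:
--  * arrows incident to k are reversed;
--  * for i, j ≠ k, the paths i → k → j add a i k * a k j arrows i → j
--    (and a j k * a k i arrows j → i); then a maximal set of disjoint
--    2-cycles is removed, leaving (c ∸ d) arrows i → j.
mutQ : {s : ℕ} → Fin s → Arrows s → Arrows s
mutQ k a i j =
  if does (i ≟ k) then a j i else
  if does (j ≟ k) then a j i else
  ((a i j + a i k * a k j) ∸ (a j i + a j k * a k i))

_^ˢ_ : Sign → ℕ → Sign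
σ ^ˢ zero  = Sign.+
σ ^ˢ suc n = σ · (σ ^ˢ n)

∏ : {s : ℕ} → (Fin s → Sign) → Sign
∏ {zero}  f = Sign.+
∏ {suc s} f = f Fin.zero · ∏ (λ j → f (Fin.suc j))

inσ : {s : ℕ} → Arrows s → (Fin s → Sign) → Fin s → Sign
inσ a σ i = ∏ (λ j → σ j ^ˢ a j i)

outσ : {s : ℕ} → Arrows s → (Fin s → Sign) → Fin s → Sign
outσ a σ i = ∏ (λ j → σ j ^ˢ a i j)

IsSigned : {s : ℕ} → ℕ → Arrows s → (Fin s → Sign) → Set
IsSigned r a σ = ∀ i → Mutable r i → inσ a σ i ≡ outσ a σ i

mutσ : {s : ℕ} → Fin s → Arrows s → (Fin s → Sign) → Fin s → Sign
mutσ k a σ i = if does (i ≟ k) then σ k · inσ a σ k else σ i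

-- Signs square to +, so a power σ ^ˢ n only depends on the parity of n, and
-- the truncated differences (c ∸ d) and (d ∸ c) produced by mutation together
-- have the parity of c + d. Hence at a vertex i ≠ k the product in·out after
-- mutation differs from the one before by the factor
-- in(k) ^ (a k i) · out(k) ^ (a i k) · in(k) ^ (a k i + a i k), which is + once
-- in(k) = out(k). At i = k, mutation just swaps in(k) and out(k).
module Submission where

open import Defs
open import Data.Nat using (ℕ; zero; suc; _+_; _*_; _∸_)
import Data.Nat.Properties as ℕ
open import Data.Fin using (Fin; _≟_)
import Data.Fin as Fin
open import Data.Sign using (Sign) renaming (_*_ to _·_; + to ⊕)
open import Data.Sign.Properties
  using (s*s≡+; *-identityʳ; *-assoc; *-comm; *-commutativeSemigroup; *-group)
open import Algebra.Properties.CommutativeSemigroup *-commutativeSemigroup using (interchange)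
open import Algebra.Properties.Group *-group using (x∙y⁻¹≈ε⇒x≈y)
open import Data.Bool using (if_then_else_)
open import Relation.Nullary using (¬_; Dec; yes; no)
open import Relation.Nullary.Decidable using (does; dec-true; dec-false)
open import Relation.Binary.PropositionalEquality

^ˢ-+ : ∀ x m n → x ^ˢ (m + n) ≡ x ^ˢ m · x ^ˢ n
^ˢ-+ x zero    n = refl
^ˢ-+ x (suc m) n = trans (cong (x ·_) (^ˢ-+ x m n)) (sym (*-assoc x _ _))

·-^ˢ : ∀ x y n → (x · y) ^ˢ n ≡ x ^ˢ n · y ^ˢ n
·-^ˢ x y zero    = refl
·-^ˢ x y (suc n) = trans (cong (x · y ·_) (·-^ˢ x y n)) (interchange x y _ _)

⊕^ˢn≡⊕ : ∀ n → ⊕ ^ˢ n ≡ ⊕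
⊕^ˢn≡⊕ zero    = refl
⊕^ˢn≡⊕ (suc n) = ⊕^ˢn≡⊕ n

^ˢ-* : ∀ x m n → x ^ˢ (m * n) ≡ (x ^ˢ m) ^ˢ n
^ˢ-* x zero    n = sym (⊕^ˢn≡⊕ n)
^ˢ-* x (suc m) n = begin
  x ^ˢ (n + m * n)           ≡⟨ ^ˢ-+ x n (m * n) ⟩
  x ^ˢ n · x ^ˢ (m * n)      ≡⟨ cong (x ^ˢ n ·_) (^ˢ-* x m n) ⟩
  x ^ˢ n · (x ^ˢ m) ^ˢ n     ≡⟨ sym (·-^ˢ x (x ^ˢ m) n) ⟩
  (x · x ^ˢ m) ^ˢ n          ∎
  where open ≡-Reasoning

^ˢ[m∸n]·^ˢ[n∸m] : ∀ x m n → x ^ˢ (m ∸ n) · x ^ˢ (n ∸ m) ≡ x ^ˢ m · x ^ˢ n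
^ˢ[m∸n]·^ˢ[n∸m] x zero    zero    = refl
^ˢ[m∸n]·^ˢ[n∸m] x zero    (suc n) = refl
^ˢ[m∸n]·^ˢ[n∸m] x (suc m) zero    = refl
^ˢ[m∸n]·^ˢ[n∸m] x (suc m) (suc n) = begin
  x ^ˢ (m ∸ n) · x ^ˢ (n ∸ m)     ≡⟨ ^ˢ[m∸n]·^ˢ[n∸m] x m n ⟩
  x ^ˢ m · x ^ˢ n                 ≡⟨ cong (_· (x ^ˢ m · x ^ˢ n)) (sym (s*s≡+ x)) ⟩
  x · x · (x ^ˢ m · x ^ˢ n)       ≡⟨ interchange x x _ _ ⟩
  x · x ^ˢ m · (x · x ^ˢ n)       ∎
  where open ≡-Reasoning

∏-cong : ∀ {s} {f g : Fin s → Sign} → (∀ j → f j ≡ g j) → ∏ f ≡ ∏ g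
∏-cong {zero}  f≗g = refl
∏-cong {suc s} f≗g = cong₂ _·_ (f≗g Fin.zero) (∏-cong (λ j → f≗g (Fin.suc j)))

∏-· : ∀ {s} (f g : Fin s → Sign) → ∏ (λ j → f j · g j) ≡ ∏ f · ∏ g
∏-· {zero}  f g = refl
∏-· {suc s} f g =
  trans (cong (f Fin.zero · g Fin.zero ·_) (∏-· (λ j → f (Fin.suc j)) (λ j → g (Fin.suc j))))
        (interchange (f Fin.zero) (g Fin.zero) _ _)

∏-^ˢ : ∀ {s} (f : Fin s → Sign) n → ∏ (λ j → f j ^ˢ n) ≡ ∏ f ^ˢ n
∏-^ˢ {zero}  f n = sym (⊕^ˢn≡⊕ n)
∏-^ˢ {suc s} f n =
  trans (cong (f Fin.zero ^ˢ n ·_) (∏-^ˢ (λ j → f (Fin.suc j)) n)) (sym (·-^ˢ _ _ n))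

∏-⊕ : ∀ {s} → ∏ {s} (λ _ → ⊕) ≡ ⊕
∏-⊕ {zero}  = refl
∏-⊕ {suc s} = ∏-⊕ {s}

single : ∀ {s} → Fin s → Sign → Fin s → Sign
single k x j = if does (j ≟ k) then x else ⊕

∏-single : ∀ {s} (k : Fin s) x → ∏ (single k x) ≡ x
∏-single {suc s} Fin.zero    x = trans (cong (x ·_) (∏-⊕ {s})) (*-identityʳ x)
∏-single {suc s} (Fin.suc k) x = ∏-single k x

single-diag : ∀ {s} (k : Fin s) x → single k x k ≡ x
single-diag k x rewrite dec-true (k ≟ k) refl = refl

single-≢ : ∀ {s} {k j : Fin s} x → ¬ j ≡ k → single k x j ≡ ⊕
single-≢ {k = k} {j} x j≢k rewrite dec-false (j ≟ k) j≢k = refl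

module _ {s : ℕ} (k : Fin s) (a : Arrows s) where

  mutQ-from-k : ∀ j → mutQ k a k j ≡ a j k
  mutQ-from-k j rewrite dec-true (k ≟ k) refl = refl

  mutQ-to-k : ∀ i → mutQ k a i k ≡ a k i
  mutQ-to-k i with i ≟ k
  ... | yes _ = refl
  ... | no  _ rewrite dec-true (k ≟ k) refl = refl

  mutQ-≢ : ∀ {i j} → ¬ i ≡ k → ¬ j ≡ k →
           mutQ k a i j ≡ (a i j + a i k * a k j) ∸ (a j i + a j k * a k i)
  mutQ-≢ {i} {j} i≢k j≢k rewrite dec-false (i ≟ k) i≢k | dec-false (j ≟ k) j≢k = refl

  mutσ-k : ∀ σ → mutσ k a σ k ≡ σ k · inσ a σ k
  mutσ-k σ rewrite dec-true (k ≟ k) refl = refl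

  mutσ-≢ : ∀ σ {j} → ¬ j ≡ k → mutσ k a σ j ≡ σ j
  mutσ-≢ σ {j} j≢k rewrite dec-false (j ≟ k) j≢k = refl

Balanced : ∀ {s} → Arrows s → (Fin s → Sign) → Fin s → Set
Balanced a σ i = inσ a σ i ≡ outσ a σ i

module _ {s : ℕ} (a : Arrows s) (q : IsQuiver a) (σ : Fin s → Sign) (k : Fin s) where

  open IsQuiver q

  mutσ-^ˢ : ∀ j n → (j ≡ k → n ≡ 0) → mutσ k a σ j ^ˢ n ≡ σ j ^ˢ n
  mutσ-^ˢ j n n≡0 with j ≟ k
  ... | yes j≡k rewrite n≡0 j≡k = refl
  ... | no  _   = refl

  inσ-mut-k : inσ (mutQ k a) (mutσ k a σ) k ≡ outσ a σ k
  inσ-mut-k = ∏-cong λ j →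
    trans (cong (mutσ k a σ j ^ˢ_) (mutQ-to-k k a j)) (mutσ-^ˢ j (a k j) λ { refl → noLoops k })

  outσ-mut-k : outσ (mutQ k a) (mutσ k a σ) k ≡ inσ a σ k
  outσ-mut-k = ∏-cong λ j →
    trans (cong (mutσ k a σ j ^ˢ_) (mutQ-from-k k a j)) (mutσ-^ˢ j (a j k) λ { refl → noLoops k })

  mut-balanced-k : Balanced a σ k → Balanced (mutQ k a) (mutσ k a σ) k
  mut-balanced-k in≡out = trans inσ-mut-k (trans (sym in≡out) (sym outσ-mut-k))

  module _ {i : Fin s} (i≢k : ¬ i ≡ k) where

    inout-term : Fin s → Sign
    inout-term j = σ j ^ˢ a j i · σ j ^ˢ a i j

    -- Contribution of the arrows between i and j created through k.
    path-term : Fin s → Sign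
    path-term j = (σ j ^ˢ a j k) ^ˢ a k i · (σ j ^ˢ a k j) ^ˢ a i k

    path-term-k : (σ k ^ˢ a k k) ^ˢ a k i · (σ k ^ˢ a k k) ^ˢ a i k ≡ ⊕
    path-term-k rewrite noLoops k | ⊕^ˢn≡⊕ (a k i) | ⊕^ˢn≡⊕ (a i k) = refl

    mut-term-≢ : ∀ {j} → ¬ j ≡ k →
      mutσ k a σ j ^ˢ mutQ k a j i · mutσ k a σ j ^ˢ mutQ k a i j ≡ inout-term j · path-term j
    mut-term-≢ {j} j≢k
      rewrite mutσ-≢ k a σ j≢k | mutQ-≢ k a j≢k i≢k | mutQ-≢ k a i≢k j≢k = begin
        x ^ˢ (c ∸ d) · x ^ˢ (d ∸ c)
          ≡⟨ ^ˢ[m∸n]·^ˢ[n∸m] x c d ⟩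
        x ^ˢ (a j i + a j k * a k i) · x ^ˢ (a i j + a i k * a k j)
          ≡⟨ cong₂ _·_ (^ˢ-+ x (a j i) _) (^ˢ-+ x (a i j) _) ⟩
        x ^ˢ a j i · x ^ˢ (a j k * a k i) · (x ^ˢ a i j · x ^ˢ (a i k * a k j))
          ≡⟨ interchange (x ^ˢ a j i) _ _ _ ⟩
        x ^ˢ a j i · x ^ˢ a i j · (x ^ˢ (a j k * a k i) · x ^ˢ (a i k * a k j))
          ≡⟨ cong (λ m → x ^ˢ a j i · x ^ˢ a i j · (x ^ˢ (a j k * a k i) · x ^ˢ m))
                  (ℕ.*-comm (a i k) (a k j)) ⟩
        x ^ˢ a j i · x ^ˢ a i j · (x ^ˢ (a j k * a k i) · x ^ˢ (a k j * a i k))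
          ≡⟨ cong₂ (λ u v → x ^ˢ a j i · x ^ˢ a i j · (u · v))
                   (^ˢ-* x (a j k) (a k i)) (^ˢ-* x (a k j) (a i k)) ⟩
        x ^ˢ a j i · x ^ˢ a i j · ((x ^ˢ a j k) ^ˢ a k i · (x ^ˢ a k j) ^ˢ a i k) ∎
      where
        open ≡-Reasoning
        x = σ j
        c = a j i + a j k * a k i
        d = a i j + a i k * a k j

    mut-term-k :
      mutσ k a σ k ^ˢ mutQ k a k i · mutσ k a σ k ^ˢ mutQ k a i k ≡
      inout-term k · inσ a σ k ^ˢ (a k i + a i k)
    mut-term-k rewrite mutσ-k k a σ | mutQ-from-k k a i | mutQ-to-k k a i = begin
      (x · X) ^ˢ a i k · (x · X) ^ˢ a k i
        ≡⟨ *-comm ((x · X) ^ˢ a i k) _ ⟩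
      (x · X) ^ˢ a k i · (x · X) ^ˢ a i k
        ≡⟨ cong₂ _·_ (·-^ˢ x X (a k i)) (·-^ˢ x X (a i k)) ⟩
      x ^ˢ a k i · X ^ˢ a k i · (x ^ˢ a i k · X ^ˢ a i k)
        ≡⟨ interchange (x ^ˢ a k i) _ _ _ ⟩
      x ^ˢ a k i · x ^ˢ a i k · (X ^ˢ a k i · X ^ˢ a i k)
        ≡⟨ cong (x ^ˢ a k i · x ^ˢ a i k ·_) (sym (^ˢ-+ X (a k i) (a i k))) ⟩
      x ^ˢ a k i · x ^ˢ a i k · X ^ˢ (a k i + a i k) ∎
      where
        open ≡-Reasoning
        x = σ k
        X = inσ a σ k

    mut-term : ∀ j → Dec (j ≡ k) →
      mutσ k a σ j ^ˢ mutQ k a j i · mutσ k a σ j ^ˢ mutQ k a i j ≡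
      inout-term j · path-term j · single k (inσ a σ k ^ˢ (a k i + a i k)) j
    mut-term j (yes refl) = trans mut-term-k (cong₂ _·_ (sym without-path-term) (sym (single-diag k _)))
      where
        without-path-term : inout-term k · path-term k ≡ inout-term k
        without-path-term = trans (cong (inout-term k ·_) path-term-k) (*-identityʳ (inout-term k))
    mut-term j (no j≢k) =
      trans (mut-term-≢ j≢k)
            (sym (trans (cong (inout-term j · path-term j ·_) (single-≢ _ j≢k)) (*-identityʳ _)))

    inσ·outσ-mut :
      inσ (mutQ k a) (mutσ k a σ) i · outσ (mutQ k a) (mutσ k a σ) i ≡
      inσ a σ i · outσ a σ i · (inσ a σ k ^ˢ a k i · outσ a σ k ^ˢ a i k)
        · inσ a σ k ^ˢ (a k i + a i k)
    inσ·outσ-mut = begin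
      ∏ (λ j → σ′ j ^ˢ a′ j i) · ∏ (λ j → σ′ j ^ˢ a′ i j)
        ≡⟨ sym (∏-· (λ j → σ′ j ^ˢ a′ j i) (λ j → σ′ j ^ˢ a′ i j)) ⟩
      ∏ (λ j → σ′ j ^ˢ a′ j i · σ′ j ^ˢ a′ i j)
        ≡⟨ ∏-cong (λ j → mut-term j (j ≟ k)) ⟩
      ∏ (λ j → inout-term j · path-term j · single k Y j)
        ≡⟨ ∏-· (λ j → inout-term j · path-term j) (single k Y) ⟩
      ∏ (λ j → inout-term j · path-term j) · ∏ (single k Y)
        ≡⟨ cong₂ _·_ (∏-· inout-term path-term) (∏-single k Y) ⟩
      ∏ inout-term · ∏ path-term · Y
        ≡⟨ cong₂ (λ u v → u · v · Y)
                 (∏-· (λ j → σ j ^ˢ a j i) (λ j → σ j ^ˢ a i j))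
                 (trans (∏-· (λ j → (σ j ^ˢ a j k) ^ˢ a k i) (λ j → (σ j ^ˢ a k j) ^ˢ a i k))
                        (cong₂ _·_ (∏-^ˢ (λ j → σ j ^ˢ a j k) (a k i))
                                   (∏-^ˢ (λ j → σ j ^ˢ a k j) (a i k)))) ⟩
      inσ a σ i · outσ a σ i · (inσ a σ k ^ˢ a k i · outσ a σ k ^ˢ a i k) · Y ∎
      where
        open ≡-Reasoning
        a′ = mutQ k a
        σ′ = mutσ k a σ
        Y = inσ a σ k ^ˢ (a k i + a i k)

    mut-balanced-≢k : Balanced a σ i → Balanced a σ k → Balanced (mutQ k a) (mutσ k a σ) i
    mut-balanced-≢k in≡out-at-i in≡out-at-k = x∙y⁻¹≈ε⇒x≈y _ _ (begin
      inσ (mutQ k a) (mutσ k a σ) i · outσ (mutQ k a) (mutσ k a σ) i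
        ≡⟨ inσ·outσ-mut ⟩
      inσ a σ i · outσ a σ i · (X ^ˢ a k i · outσ a σ k ^ˢ a i k) · Y
        ≡⟨ cong₂ (λ u v → u · (X ^ˢ a k i · v ^ˢ a i k) · Y)
                 (trans (cong (_· outσ a σ i) in≡out-at-i) (s*s≡+ (outσ a σ i)))
                 (sym in≡out-at-k) ⟩
      X ^ˢ a k i · X ^ˢ a i k · Y
        ≡⟨ cong (_· Y) (sym (^ˢ-+ X (a k i) (a i k))) ⟩
      Y · Y
        ≡⟨ s*s≡+ Y ⟩
      ⊕ ∎)
      where
        open ≡-Reasoning
        X = inσ a σ k
        Y = X ^ˢ (a k i + a i k)

  mut-balanced : ∀ i → Dec (i ≡ k) →
    Balanced a σ i → Balanced a σ k → Balanced (mutQ k a) (mutσ k a σ) i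
  mut-balanced i (yes refl) _    at-k = mut-balanced-k at-k
  mut-balanced i (no i≢k)   at-i at-k = mut-balanced-≢k i≢k at-i at-k

proposition9p24 : ∀ {r s : ℕ} (a : Arrows s) → IsQuiver a →
    (σ : Fin s → Sign) → IsSigned r a σ →
    (k : Fin s) → Mutable r k →
    IsSigned r (mutQ k a) (mutσ k a σ)
proposition9p24 a q σ signed k k-mut i i-mut =
  mut-balanced a q σ k i (i ≟ k) (signed i i-mut) (signed k k-mut)
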